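{- Let $P$ be a two-dimensional poset with realizers $L_1, L_2$ and a partition of its elements into chains given by a function $\mathcal{C}$ (distinct elements with equal $\mathcal{C}$-value are comparable). Then $L_1$ (and likewise $L_2$) does not contain distinct elements $a_1, b_2, a, a_2, b_1$ appearing in this order with $\mathcal{C}(a_1)=\mathcal{C}(a_2)=\mathcal{C}(a)$, $\mathcal{C}(b_1)=\mathcal{C}(b_2)$, $a_1 \prec b_1$ and $b_2 \prec a_2$.
   Context: A poset $P=(X,<)$ is a finite set with a transitive, asymmetric relation; a chain is a set of pairwise comparable elements. $a\prec b$ denotes a cover relation: $a<b$ and no $c$ satisfies $a<c<b$. A linear extension is a total order $L$ of $X$ with $a<_L b$ whenever $a<_P b$. $P$ is two-dimensional with realizers $L_1,L_2$ if $L_1,L_2$ are linear extensions such that $a<b$ in $P$ iff $a<b$ in both $L_1$ and $L_2$. -}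

module Defs where

open import Data.Nat using (ℕ)
open import Data.Fin using (Fin)
open import Data.Product using (_×_; ∃-syntax)
open import Data.Sum using (_⊎_)
open import Relation.Nullary using (¬_)
open import Relation.Binary.PropositionalEquality using (_≡_; _≢_)

record Poset (n : ℕ) : Set₁ where
  field
    _<_   : Fin n → Fin n → Set
    trans : ∀ {a b c} → a < b → b < c → a < c
    asym  : ∀ {a b} → a < b → ¬ (b < a)

record LinearOrder (n : ℕ) : Set₁ where
  field
    _<_   : Fin n → Fin n → Set
    trans : ∀ {a b c} → a < b → b < c → a < c
    asym  : ∀ {a b} → a < b → ¬ (b < a)
    total : ∀ {a b} → a ≢ b → (a < b) ⊎ (b < a)

module _ {n : ℕ} (P : Poset n) where
  open Poset P

  Covers : Fin n → Fin n → Set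
  Covers a b = (a < b) × ¬ (∃[ c ] ((a < c) × (c < b)))

  IsLinearExtension : LinearOrder n → Set
  IsLinearExtension L = ∀ {a b} → a < b → LinearOrder._<_ L a b

  IsRealizer : LinearOrder n → LinearOrder n → Set
  IsRealizer L₁ L₂ =
    IsLinearExtension L₁ × IsLinearExtension L₂ ×
    (∀ a b → LinearOrder._<_ L₁ a b → LinearOrder._<_ L₂ a b → a < b)

  IsChainPartition : {K : Set} → (Fin n → K) → Set
  IsChainPartition C = ∀ a b → a ≢ b → C a ≡ C b → (a < b) ⊎ (b < a)

  Pattern : {K : Set} → (Fin n → K) → LinearOrder n → Set
  Pattern C L =
    ∃[ a₁ ] ∃[ b₂ ] ∃[ a ] ∃[ a₂ ] ∃[ b₁ ]
      ( (a₁ ≢ b₂) × (a₁ ≢ a) × (a₁ ≢ a₂) × (a₁ ≢ b₁) × (b₂ ≢ a) × (b₂ ≢ a₂)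
      × (b₂ ≢ b₁) × (a ≢ a₂) × (a ≢ b₁) × (a₂ ≢ b₁)
      × (a₁ <L b₂) × (b₂ <L a) × (a <L a₂) × (a₂ <L b₁)
      × (C a₁ ≡ C a₂) × (C a₂ ≡ C a) × (C b₁ ≡ C b₂)
      × Covers a₁ b₁ × Covers b₂ a₂ )
    where _<L_ = LinearOrder._<_ L

{-# OPTIONS --safe #-}
module Submission where

open import Defs
open import Data.Nat using (ℕ)
open import Data.Fin using (Fin)
open import Data.Product using (_×_; _,_)
open import Data.Sum using (inj₁; inj₂)
open import Data.Empty using (⊥-elim)
open import Relation.Nullary using (¬_)
open import Relation.Binary.PropositionalEquality using (_≡_; _≢_; sym; trans)

-- In L the chain relations a₁ < a < a₂ and b₂ < b₁ are forced. In the second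
-- realizer L' either a₁ precedes b₂, and then a₁ < b₂ < b₁ breaks the cover
-- a₁ ≺ b₁, or b₂ precedes a₁ and hence a, and then b₂ < a < a₂ breaks b₂ ≺ a₂.

module _ {n : ℕ} (P : Poset n) where
  open Poset P using (_<_)

  chain-ordered-by-extension : ∀ {K : Set} {C : Fin n → K} (L : LinearOrder n)
    → IsLinearExtension P L → IsChainPartition P C
    → ∀ {a b} → a ≢ b → C a ≡ C b → LinearOrder._<_ L a b → a < b
  chain-ordered-by-extension L ext cp {a} {b} a≢b ca≡cb a<Lb with cp a b a≢b ca≡cb
  ... | inj₁ a<b = a<b
  ... | inj₂ b<a = ⊥-elim (LinearOrder.asym L a<Lb (ext b<a))

  ¬pattern-in-first-realizer : ∀ {K : Set} (C : Fin n → K) (L L' : LinearOrder n)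
    → IsRealizer P L L' → IsChainPartition P C → ¬ Pattern P C L
  ¬pattern-in-first-realizer C L L' (ext , ext' , realize) cp
    ( a₁ , b₂ , a , a₂ , b₁
    , a₁≢b₂ , a₁≢a , _ , _ , _ , _ , b₂≢b₁ , a≢a₂ , _ , _
    , a₁<b₂ , b₂<a , a<a₂ , a₂<b₁
    , Ca₁≡Ca₂ , Ca₂≡Ca , Cb₁≡Cb₂
    , (_ , a₁≺b₁) , (_ , b₂≺a₂) )
    with LinearOrder.total L' a₁≢b₂
  ... | inj₁ a₁<'b₂ = a₁≺b₁ (b₂ , realize a₁ b₂ a₁<b₂ a₁<'b₂ , b₂<Pb₁)
    where
      b₂<Pb₁ : b₂ < b₁
      b₂<Pb₁ = chain-ordered-by-extension L ext cp b₂≢b₁ (sym Cb₁≡Cb₂)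
                 (LinearOrder.trans L b₂<a (LinearOrder.trans L a<a₂ a₂<b₁))
  ... | inj₂ b₂<'a₁ = b₂≺a₂ (a , realize b₂ a b₂<a b₂<'a , a<Pa₂)
    where
      a₁<Pa : a₁ < a
      a₁<Pa = chain-ordered-by-extension L ext cp a₁≢a (trans Ca₁≡Ca₂ Ca₂≡Ca)
                (LinearOrder.trans L a₁<b₂ b₂<a)
      b₂<'a : LinearOrder._<_ L' b₂ a
      b₂<'a = LinearOrder.trans L' b₂<'a₁ (ext' a₁<Pa)
      a<Pa₂ : a < a₂
      a<Pa₂ = chain-ordered-by-extension L ext cp a≢a₂ (sym Ca₂≡Ca) a<a₂

  realizer-swap : ∀ (L L' : LinearOrder n) → IsRealizer P L L' → IsRealizer P L' L
  realizer-swap L L' (ext , ext' , realize) = ext' , ext , λ a b p q → realize a b q p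

proposition3 : {n : ℕ} {K : Set} (P : Poset n) (L₁ L₂ : LinearOrder n) (C : Fin n → K)
    → IsRealizer P L₁ L₂ → IsChainPartition P C
    → ¬ Pattern P C L₁ × ¬ Pattern P C L₂
proposition3 P L₁ L₂ C realizer cp =
  ¬pattern-in-first-realizer P C L₁ L₂ realizer cp ,
  ¬pattern-in-first-realizer P C L₂ L₁ (realizer-swap P L₁ L₂ realizer) cp
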